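{- Let $\pi\in T_n$ with $\mathrm{lis}(\pi)=k$, and let $[i_1,j_1],\dots,[i_{n-k},j_{n-k}]$ be the matched pairs of $\pi$ (with $i_l<j_l$ for all $l$). Then: (a) for every matched pair $[i,j]$ with $i<j$, $c(i,j)$ is even if and only if $\pi_i+j$ is even; (b) $\mathrm{inv}(\pi)=c(i_1,j_1)+c(i_2,j_2)+\dots+c(i_{n-k},j_{n-k})+n-k$.
   Context: $T_n$ is the set of $321$-avoiding permutations $\pi=\pi_1\cdots\pi_n\in\mathcal S_n$; $\mathrm{lis}(\pi)$ is the length of a longest increasing subsequence. An excedance of $\pi$ is an index $i$ with $\pi_i>i$; an anti-excedance is an index $i$ with $\pi_i<i$. $\mathrm{inv}(\pi)$ is the number of pairs $i<j$ with $\pi_i>\pi_j$. Matching: let $i_1<\dots<i_s$ be the excedances and $j_1<\dots<j_t$ the anti-excedances of $\pi$. Start with $a=b=1$. While $a\le s$ and $b\le t$, perform one of the following: if $i_a>j_b$, increase $b$ by $1$; if $\pi_{i_a}<\pi_{j_b}$, increase $a$ by $1$; if $i_a<j_b$ and $\pi_{i_a}>\pi_{j_b}$, declare $[i_a,j_b]$ a matched pair and increase both $a$ and $b$ by $1$. (For $\pi\in T_n$ this procedure produces exactly $n-\mathrm{lis}(\pi)$ matched pairs, each consisting of an excedance $i$ and an anti-excedance $j$ with $i<j$.) For a matched pair $[i,j]$ with $i<j$, $c(i,j)$ denotes the number of indices $l$ such that either $i<l<j$ and $\pi_l>\pi_i$, or $l>j$ and $\pi_j<\pi_l<\pi_i$.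 -}

module Defs where

open import Data.Nat using (ℕ; zero; suc; _+_; _≤_; _<ᵇ_)
import Data.Bool
import Data.Product
open import Data.Bool using (Bool; true; false; if_then_else_; _∧_; _∨_)
open import Data.Fin as F using (Fin; toℕ)
open import Data.Fin.Permutation using (Permutation′; _⟨$⟩ʳ_)
open import Data.List using (List; []; _∷_; length; filter; allFin; map)
open import Data.Nat.ListAction using (sum)
open import Data.List.Relation.Unary.Linked using (Linked)
open import Data.Product using (_×_; _,_; ∃; ∃-syntax)
open import Relation.Nullary using (¬_)
open import Relation.Nullary.Decidable using (yes; no)
open import Relation.Binary.PropositionalEquality using (_≡_)

-- Permutations of [n] are library permutations of Fin n; the 1-based
-- position of an index i is pos i = toℕ i + 1, its 1-based value is val π i.

module _ {n : ℕ} (π : Permutation′ n) where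

  pos : Fin n → ℕ
  pos i = suc (toℕ i)

  val : Fin n → ℕ
  val i = suc (toℕ (π ⟨$⟩ʳ i))

  Avoids321 : Set
  Avoids321 = ¬ (∃[ i ] ∃[ j ] ∃[ l ]
     (i F.< j × j F.< l × (π ⟨$⟩ʳ l) F.< (π ⟨$⟩ʳ j) × (π ⟨$⟩ʳ j) F.< (π ⟨$⟩ʳ i)))

  IncSubseq : List (Fin n) → Set
  IncSubseq = Linked (λ a b → a F.< b × (π ⟨$⟩ʳ a) F.< (π ⟨$⟩ʳ b))

  IsLis : ℕ → Set
  IsLis k = (∃[ s ] (IncSubseq s × length s ≡ k))
          × (∀ s → IncSubseq s → length s ≤ k)

  isExc : Fin n → Bool
  isExc i = pos i <ᵇ val i

  isAntiExc : Fin n → Bool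
  isAntiExc i = val i <ᵇ pos i

  excedances : List (Fin n)
  excedances = filter (λ i → Data.Bool._≟_ (isExc i) true) (allFin n)

  antiExcedances : List (Fin n)
  antiExcedances = filter (λ i → Data.Bool._≟_ (isAntiExc i) true) (allFin n)

  matchAux : List (Fin n) → List (Fin n) → List (Fin n × Fin n)
  matchAux [] _ = []
  matchAux (_ ∷ _) [] = []
  matchAux (i ∷ is) (j ∷ js) =
    if pos j <ᵇ pos i then matchAux (i ∷ is) js
    else if val i <ᵇ val j then matchAux is (j ∷ js)
    else (i , j) ∷ matchAux is js

  matchedPairs : List (Fin n × Fin n)
  matchedPairs = matchAux excedances antiExcedances

  cnt : Fin n → Fin n → ℕ
  cnt i j = length (filter (λ l → Data.Bool._≟_ (cond l) true) (allFin n))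
    where
    cond : Fin n → Bool
    cond l = ((pos i <ᵇ pos l) ∧ (pos l <ᵇ pos j) ∧ (val i <ᵇ val l))
           ∨ ((pos j <ᵇ pos l) ∧ (val j <ᵇ val l) ∧ (val l <ᵇ val i))

  inv : ℕ
  inv = sum (map (λ i → length (filter (λ j →
          Data.Bool._≟_ ((pos i <ᵇ pos j) ∧ (val j <ᵇ val i)) true) (allFin n)))
        (allFin n))

  sumC : ℕ
  sumC = sum (map (λ p → cnt (Data.Product.proj₁ p) (Data.Product.proj₂ p)) matchedPairs)

{-# OPTIONS --safe #-}
-- In a 321-avoiding permutation every inversion (a, b) goes from an excedance a
-- to an anti-excedance b, and both the excedances and the anti-excedances form
-- increasing subsequences.  Run the matching on these two chains.  A discarded
-- excedance i lies below all remaining anti-excedances, a discarded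
-- anti-excedance j lies left of all remaining excedances, and a matched pair
-- [i, j] is an inversion which, besides [i, j] itself, forms inversions exactly
-- with the remaining excedances between i and j and the remaining
-- anti-excedances right of j below π_i; by 321-avoidance these are the l
-- counted by c(i, j).  Hence inv(π) = Σ (c(i, j) + 1).
--
-- With V the number of l ≤ j with π_l < π_i, counting the values below π_i and
-- the positions up to j gives π_i + j = c(i, j) + 2 (V + 1), so c(i, j) ≡ π_i + j
-- (mod 2).
--
-- An increasing subsequence contains at most one element of each matched pair,
-- so lis(π) ≤ n − #pairs.  Conversely, along the matching one keeps an
-- inversion-free set with all but one element of each pair; with the fixed
-- points it is an increasing subsequence of length n − #pairs.
module Submission where

open import Defs
import Algebra.Properties.CommutativeMonoid.Sum as VecSum
open import Data.Bool using (Bool; true; false; T; not; _∧_; _∨_)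
import Data.Bool as Bool
open import Data.Bool.Properties using (T-∧; T-∨; T-≡; T-not-≡; ∧-comm)
open import Data.Empty using (⊥; ⊥-elim)
open import Data.Fin as F using (Fin; toℕ)
open import Data.Fin.Permutation using (Permutation′; _⟨$⟩ʳ_)
open import Data.Fin.Properties using (toℕ-injective; toℕ<n) renaming (_≟_ to _≟ᶠ_)
open import Data.List using (List; []; _∷_; length; filter; allFin; map; tabulate)
open import Data.List.Membership.Propositional using (_∈_; find; lose)
open import Data.List.Membership.Propositional.Properties using (∈-allFin)
import Data.List.Membership.DecPropositional as DecMembership
open import Data.List.Properties using (map-cong; map-cong-local; length-tabulate)
open import Data.List.Relation.Unary.All as All using (All; []; _∷_)
import Data.List.Relation.Unary.All.Properties as Allₚ
open import Data.List.Relation.Unary.AllPairs as AllPairs using (AllPairs; []; _∷_)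
import Data.List.Relation.Unary.AllPairs.Properties as AllPairsₚ
open import Data.List.Relation.Unary.Any using (here; there; any?)
import Data.List.Relation.Unary.Linked.Properties as Linkedₚ
open import Data.List.Relation.Unary.Unique.Propositional using (Unique)
open import Data.Nat using (ℕ; zero; suc; _+_; _*_; _∸_; _<_; _≤_; _<ᵇ_; z≤n; s≤s)
open import Data.Nat.Divisibility using (_∣_; ∣m∣n⇒∣m+n; ∣m+n∣m⇒∣n; m∣m*n)
open import Data.Nat.ListAction using (sum)
open import Data.Nat.Properties
open import Algebra.Properties.CommutativeSemigroup +-commutativeSemigroup
  using (interchange; x∙yz≈y∙xz; xy∙z≈xz∙y)
open import Data.Nat.Tactic.RingSolver using (solve-∀)
open import Data.Product as Product using (_×_; _,_; proj₁; proj₂; ∃-syntax)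
open import Data.Product.Function.NonDependent.Propositional using (_×-⇔_)
open import Data.Sum as Sum using (_⊎_; inj₁; inj₂)
open import Data.Sum.Function.Propositional using (_⊎-⇔_)
open import Data.Unit using (⊤)
open import Function using (_∘_; const)
open import Function.Bundles using (_⇔_; mk⇔; Equivalence; Injection)
open import Function.Construct.Composition using (_⇔-∘_)
open import Function.Construct.Identity using (⇔-id)
open import Function.Properties.Inverse using (Inverse⇒Injection)
open import Relation.Binary using (tri<; tri≈; tri>)
open import Relation.Binary.PropositionalEquality
open import Relation.Nullary using (¬_; Dec; does; yes; no)
open import Relation.Nullary.Decidable using (T?)
open import Relation.Nullary.Reflects using (ofʸ; ofⁿ)

open Equivalence using (to; from)
open VecSum +-0-commutativeMonoid using (sum-permute) renaming (sum to sumᶠ)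

𝟙 : Bool → ℕ
𝟙 true  = 1
𝟙 false = 0

module _ {a} {A : Set a} where

  -- The form in which Defs filters by a boolean predicate.
  _≟true : (P : A → Bool) → (x : A) → Dec (P x ≡ true)
  (P ≟true) x = P x Bool.≟ true

  count : (A → Bool) → List A → ℕ
  count P []       = 0
  count P (x ∷ xs) = 𝟙 (P x) + count P xs

  Disjoint : (A → Bool) → (A → Bool) → Set a
  Disjoint P Q = ∀ x → T (P x) → T (Q x) → ⊥

  length-filter : ∀ P xs → length (filter (P ≟true) xs) ≡ count P xs
  length-filter P [] = refl
  length-filter P (x ∷ xs) with P x
  ... | true  = cong suc (length-filter P xs)
  ... | false = length-filter P xs

  count-true : ∀ xs → count (const true) xs ≡ length xs
  count-true []       = refl
  count-true (x ∷ xs) = cong suc (count-true xs)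

  count-≤-length : ∀ P xs → count P xs ≤ length xs
  count-≤-length P []       = z≤n
  count-≤-length P (x ∷ xs) with P x
  ... | true  = s≤s (count-≤-length P xs)
  ... | false = m≤n⇒m≤1+n (count-≤-length P xs)

  count-∷-¬ : ∀ P x xs → ¬ T (P x) → count P (x ∷ xs) ≡ count P xs
  count-∷-¬ P x xs ¬Px with P x
  ... | true  = ⊥-elim (¬Px _)
  ... | false = refl

  count-∷-T : ∀ P x xs → T (P x) → count P (x ∷ xs) ≡ suc (count P xs)
  count-∷-T P x xs Px with P x
  ... | true  = refl
  ... | false = ⊥-elim Px

  count-≗ : ∀ {P Q} → (∀ x → P x ≡ Q x) → ∀ xs → count P xs ≡ count Q xs
  count-≗ P≗Q []       = refl
  count-≗ P≗Q (x ∷ xs) = cong₂ (λ b c → 𝟙 b + c) (P≗Q x) (count-≗ P≗Q xs)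

  count-cong-local : ∀ {P Q xs} → All (λ x → T (P x) ⇔ T (Q x)) xs → count P xs ≡ count Q xs
  count-cong-local {xs = []} [] = refl
  count-cong-local {P} {Q} {x ∷ xs} (P⇔Q ∷ rest) with P x | Q x
  ... | true  | true  = cong suc (count-cong-local rest)
  ... | false | false = count-cong-local rest
  ... | true  | false = ⊥-elim (to P⇔Q _)
  ... | false | true  = ⊥-elim (from P⇔Q _)

  count-cong : ∀ {P Q} → (∀ x → T (P x) ⇔ T (Q x)) → ∀ xs → count P xs ≡ count Q xs
  count-cong P⇔Q xs = count-cong-local (All.universal P⇔Q xs)

  count-none : ∀ {P xs} → All (λ x → ¬ T (P x)) xs → count P xs ≡ 0
  count-none [] = refl
  count-none {P} {x ∷ xs} (¬Px ∷ rest) with P x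
  ... | true  = ⊥-elim (¬Px _)
  ... | false = count-none rest

  count-mono : ∀ {P Q} → (∀ x → T (P x) → T (Q x)) → ∀ xs → count P xs ≤ count Q xs
  count-mono P⇒Q [] = z≤n
  count-mono {P} {Q} P⇒Q (x ∷ xs) with P x | Q x | P⇒Q x
  ... | true  | true  | _    = s≤s (count-mono P⇒Q xs)
  ... | true  | false | P⇒Qx = ⊥-elim (P⇒Qx _)
  ... | false | true  | _    = m≤n⇒m≤1+n (count-mono P⇒Q xs)
  ... | false | false | _    = count-mono P⇒Q xs

  count-mono-< : ∀ {P Q y xs} → (∀ x → T (P x) → T (Q x)) → y ∈ xs → T (Q y) → ¬ T (P y) →
                 count P xs < count Q xs
  count-mono-< {P} {Q} {xs = x ∷ xs} P⇒Q (here refl) Qx ¬Px with P x | Q x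
  ... | true  | _     = ⊥-elim (¬Px _)
  ... | false | false = ⊥-elim Qx
  ... | false | true  = s≤s (count-mono P⇒Q xs)
  count-mono-< {P} {Q} {xs = x ∷ xs} P⇒Q (there y∈) Qy ¬Py with P x | Q x | P⇒Q x
  ... | true  | false | P⇒Qx = ⊥-elim (P⇒Qx _)
  ... | true  | true  | _    = s≤s (count-mono-< P⇒Q y∈ Qy ¬Py)
  ... | false | true  | _    = m<n⇒m<1+n (count-mono-< P⇒Q y∈ Qy ¬Py)
  ... | false | false | _    = count-mono-< P⇒Q y∈ Qy ¬Py

  count-split : ∀ (P Q : A → Bool) xs → count P xs ≡ count (λ x → P x ∧ Q x) xs + count (λ x → P x ∧ not (Q x)) xs
  count-split P Q [] = refl
  count-split P Q (x ∷ xs) with P x | Q x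
  ... | true  | true  = cong suc (count-split P Q xs)
  ... | true  | false = trans (cong suc (count-split P Q xs)) (sym (+-suc _ _))
  ... | false | _     = count-split P Q xs

  count-∨ : ∀ {P Q} → Disjoint P Q → ∀ xs → count (λ x → P x ∨ Q x) xs ≡ count P xs + count Q xs
  count-∨ P#Q [] = refl
  count-∨ {P} {Q} P#Q (x ∷ xs) with P x | Q x | P#Q x
  ... | true  | true  | P#Qx = ⊥-elim (P#Qx _ _)
  ... | true  | false | _    = cong suc (count-∨ P#Q xs)
  ... | false | true  | _    = trans (cong suc (count-∨ P#Q xs)) (sym (+-suc _ _))
  ... | false | false | _    = count-∨ P#Q xs

  count-filter-implied : ∀ {P Q} → (∀ x → T (P x) → T (Q x)) → ∀ xs →
                         count P (filter (Q ≟true) xs) ≡ count P xs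
  count-filter-implied P⇒Q [] = refl
  count-filter-implied {P} {Q} P⇒Q (x ∷ xs) with Q x | P⇒Q x
  ... | true  | _    = cong (𝟙 (P x) +_) (count-filter-implied P⇒Q xs)
  ... | false | P⇒Qx with P x
  ...   | true  = ⊥-elim (P⇒Qx _)
  ...   | false = count-filter-implied P⇒Q xs

  count-partition : ∀ {E A} → Disjoint E A → ∀ P xs →
    count P xs ≡ count P (filter (E ≟true) xs) + count P (filter (A ≟true) xs)
                 + count (λ x → P x ∧ not (E x ∨ A x)) xs
  count-partition E#A P [] = refl
  count-partition {E} {A} E#A P (x ∷ xs) with E x | A x | E#A x | count-partition E#A P xs
  ... | true  | true  | E#Ax | _  = ⊥-elim (E#Ax _ _)
  ... | true  | false | _    | ih with P x
  ...   | true  = cong suc ih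
  ...   | false = ih
  count-partition {E} {A} E#A P (x ∷ xs) | false | true | _ | ih with P x
  ...   | true  = trans (cong suc ih)
                     (cong (_+ count (λ y → P y ∧ not (E y ∨ A y)) xs) (sym (+-suc (count P (filter (E ≟true) xs)) _)))
  ...   | false = ih
  count-partition {E} {A} E#A P (x ∷ xs) | false | false | _ | ih with P x
  ...   | true  = trans (cong suc ih) (sym (+-suc _ _))
  ...   | false = ih

module _ {a} {A : Set a} where

  sum-map-+ : ∀ (f g : A → ℕ) xs → sum (map (λ x → f x + g x) xs) ≡ sum (map f xs) + sum (map g xs)
  sum-map-+ f g []       = refl
  sum-map-+ f g (x ∷ xs) = trans (cong (f x + g x +_) (sum-map-+ f g xs))
                                 (interchange (f x) (g x) (sum (map f xs)) (sum (map g xs)))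

  sum-map-𝟙 : ∀ (P : A → Bool) xs → sum (map (λ x → 𝟙 (P x)) xs) ≡ count P xs
  sum-map-𝟙 P []       = refl
  sum-map-𝟙 P (x ∷ xs) = cong (𝟙 (P x) +_) (sum-map-𝟙 P xs)

  sum-map-suc : ∀ (f : A → ℕ) xs → sum (map (λ x → suc (f x)) xs) ≡ length xs + sum (map f xs)
  sum-map-suc f []       = refl
  sum-map-suc f (x ∷ xs) = cong suc (trans (cong (f x +_) (sum-map-suc f xs)) (x∙yz≈y∙xz (f x) (length xs) _))

  sum-map-filter : ∀ (f : A → ℕ) {Q} → (∀ x → ¬ T (Q x) → f x ≡ 0) → ∀ xs →
                   sum (map f (filter (Q ≟true) xs)) ≡ sum (map f xs)
  sum-map-filter f     f0 []       = refl
  sum-map-filter f {Q} f0 (x ∷ xs) with Q x | f0 x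
  ... | true  | _   = cong (f x +_) (sum-map-filter f f0 xs)
  ... | false | fx0 = trans (sum-map-filter f f0 xs) (cong (_+ sum (map f xs)) (sym (fx0 (λ ()))))

module _ {a} {A : Set a} where

  count-tabulate : ∀ {m} P (f : Fin m → A) → count P (tabulate f) ≡ sumᶠ (λ l → 𝟙 (P (f l)))
  count-tabulate {zero}  P f = refl
  count-tabulate {suc m} P f = cong (𝟙 (P (f F.zero)) +_) (count-tabulate P (f ∘ F.suc))

count-allFin-suc : ∀ {n} P → count P (allFin (suc n)) ≡ 𝟙 (P F.zero) + count (P ∘ F.suc) (allFin n)
count-allFin-suc P = trans (count-tabulate P (λ l → l)) (cong (𝟙 (P F.zero) +_) (sym (count-tabulate (P ∘ F.suc) (λ l → l))))

count-permute : ∀ {n} (π : Permutation′ n) P → count (λ l → P (π ⟨$⟩ʳ l)) (allFin n) ≡ count P (allFin n)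
count-permute {n} π P = begin
  count (λ l → P (π ⟨$⟩ʳ l)) (allFin n) ≡⟨ count-tabulate (λ l → P (π ⟨$⟩ʳ l)) (λ l → l) ⟩
  sumᶠ (λ l → 𝟙 (P (π ⟨$⟩ʳ l)))         ≡⟨ sum-permute (λ l → 𝟙 (P l)) π ⟨
  sumᶠ (λ l → 𝟙 (P l))                   ≡⟨ count-tabulate P (λ l → l) ⟨
  count P (allFin n)                     ∎
  where open ≡-Reasoning

count-toℕ< : ∀ {n} c → c ≤ n → count (λ l → toℕ l <ᵇ c) (allFin n) ≡ c
count-toℕ< {zero}  zero    z≤n       = refl
count-toℕ< {suc n} zero    z≤n       = trans (count-allFin-suc {n} (λ l → toℕ l <ᵇ 0)) (count-toℕ< {n} zero z≤n)
count-toℕ< {suc n} (suc c) (s≤s c≤n) = trans (count-allFin-suc {n} (λ l → toℕ l <ᵇ suc c)) (cong suc (count-toℕ< c c≤n))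

count-≟ : ∀ {n} (x : Fin n) → count (λ l → does (l ≟ᶠ x)) (allFin n) ≡ 1
count-≟ {suc n} F.zero    = trans (count-allFin-suc {n} (λ l → does (l ≟ᶠ F.zero)))
  (cong suc (count-none {P = λ l → does (F.suc l ≟ᶠ F.zero)} (All.universal (λ _ ()) (allFin n))))
count-≟ {suc n} (F.suc x) = trans (count-allFin-suc {n} (λ l → does (l ≟ᶠ F.suc x))) (count-≟ x)

T-<ᵇ : ∀ {m k} → T (m <ᵇ k) ⇔ m < k
T-<ᵇ = mk⇔ (<ᵇ⇒< _ _) <⇒<ᵇ

T-not-<ᵇ : ∀ {m k} → T (not (m <ᵇ k)) ⇔ k ≤ m
T-not-<ᵇ {m} {k} with m <ᵇ k | <ᵇ-reflects-< m k
... | true  | ofʸ m<k = mk⇔ ⊥-elim (<⇒≱ m<k)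
... | false | ofⁿ m≮k = mk⇔ (const (≮⇒≥ m≮k)) (const _)

T-∧³ : ∀ {x y z} → T (x ∧ y ∧ z) ⇔ (T x × T y × T z)
T-∧³ = (⇔-id _ ×-⇔ T-∧) ⇔-∘ T-∧

T-⇔ : ∀ {x y} {A B : Set} → T x ⇔ A → T y ⇔ B → A ⇔ B → T x ⇔ T y
T-⇔ x⇔A y⇔B A⇔B = mk⇔ (from y⇔B ∘ to A⇔B ∘ to x⇔A) (from x⇔A ∘ from A⇔B ∘ to y⇔B)

∣⇔∣+* : ∀ d m k → (d ∣ m) ⇔ (d ∣ m + d * k)
∣⇔∣+* d m k = mk⇔ (λ d∣m → ∣m∣n⇒∣m+n d∣m (m∣m*n k))
                  (λ d∣m+dk → ∣m+n∣m⇒∣n (subst (d ∣_) (+-comm m (d * k)) d∣m+dk) (m∣m*n k))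

T-does : ∀ {p} {P : Set p} (P? : Dec P) → T (does P?) ⇔ P
T-does (yes p) = mk⇔ (const p) (const _)
T-does (no ¬p) = mk⇔ ⊥-elim ¬p

AllPairs-strengthen : ∀ {a} {A : Set a} {Q : A → Set} {R R′ : A → A → Set} →
  (∀ {x y} → Q x → Q y → R x y → R′ x y) → ∀ {xs} → All Q xs → AllPairs R xs → AllPairs R′ xs
AllPairs-strengthen R⇒R′ []         []          = []
AllPairs-strengthen R⇒R′ (Qx ∷ Qxs) (Rx ∷ Rxs) =
  All.zipWith (λ (Qy , Rxy) → R⇒R′ Qx Qy Rxy) (Qxs , Rx) ∷ AllPairs-strengthen R⇒R′ Qxs Rxs

AllPairs-related : ∀ {a} {A : Set a} {R : A → A → Set} {xs x y} → AllPairs R xs → x ∈ xs → y ∈ xs →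
                   x ≡ y ⊎ R x y ⊎ R y x
AllPairs-related (_   ∷ _)   (here refl) (here refl) = inj₁ refl
AllPairs-related (Rx ∷ _)   (here refl) (there y∈)  = inj₂ (inj₁ (All.lookup Rx y∈))
AllPairs-related (Rx ∷ _)   (there x∈)  (here refl) = inj₂ (inj₂ (All.lookup Rx x∈))
AllPairs-related (_  ∷ Rxs) (there x∈)  (there y∈)  = AllPairs-related Rxs x∈ y∈

module _ {n : ℕ} where

  open DecMembership (_≟ᶠ_ {n}) using (_∈?_)

  _∈ᵇ_ : Fin n → List (Fin n) → Bool
  l ∈ᵇ xs = does (l ∈? xs)

  insert : Fin n → (Fin n → Bool) → Fin n → Bool
  insert x S l = does (l ≟ᶠ x) ∨ S l

  T-∈ᵇ : ∀ {l xs} → T (l ∈ᵇ xs) ⇔ l ∈ xs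
  T-∈ᵇ {l} {xs} = T-does (l ∈? xs)

  count-∈ᵇ : ∀ {xs} → Unique xs → count (_∈ᵇ xs) (allFin n) ≡ length xs
  count-∈ᵇ {[]}     _            = count-none (All.universal (λ _ ()) (allFin n))
  count-∈ᵇ {x ∷ xs} (x∉xs ∷ xs!) = begin
    count (_∈ᵇ (x ∷ xs)) (allFin n)                           ≡⟨ count-∨ disjoint (allFin n) ⟩
    count (λ l → does (l ≟ᶠ x)) (allFin n) + count (_∈ᵇ xs) (allFin n) ≡⟨ cong₂ _+_ (count-≟ x) (count-∈ᵇ xs!) ⟩
    suc (length xs)                                            ∎
    where
    open ≡-Reasoning
    disjoint : Disjoint (λ l → does (l ≟ᶠ x)) (_∈ᵇ xs)
    disjoint l l≡x l∈xs with to (T-does (l ≟ᶠ x)) l≡x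
    ... | refl = All.lookup x∉xs (to T-∈ᵇ l∈xs) refl

  count-insert : ∀ S x → ¬ T (S x) → count (insert x S) (allFin n) ≡ suc (count S (allFin n))
  count-insert S x ¬Sx = trans (count-∨ disjoint (allFin n)) (cong (_+ count S (allFin n)) (count-≟ x))
    where
    disjoint : Disjoint (λ l → does (l ≟ᶠ x)) S
    disjoint l l≡x Sl with to (T-does (l ≟ᶠ x)) l≡x
    ... | refl = ¬Sx Sl

  insert-elim : ∀ {p} {P : Fin n → Set p} {S x} → P x → (∀ l → T (S l) → P l) → ∀ l → T (insert x S l) → P l
  insert-elim {P = P} {S} {x} Px PS l t with to T-∨ t
  ... | inj₁ l≡x = subst P (sym (to (T-does (l ≟ᶠ x)) l≡x)) Px
  ... | inj₂ Sl  = PS l Sl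

module Perm {n : ℕ} (π : Permutation′ n) where

  -- 0-based: pos π l is suc (pos₀ l) and val π l is suc (val₀ l), so the
  -- comparisons _<ᵇ_ in Defs reduce to comparisons of pos₀ and val₀.
  pos₀ val₀ : Fin n → ℕ
  pos₀ = toℕ
  val₀ l = toℕ (π ⟨$⟩ʳ l)

  _≺_ _≼_ Inversion : Fin n → Fin n → Set
  a ≺ b = pos₀ a < pos₀ b × val₀ a < val₀ b
  a ≼ b = pos₀ a ≤ pos₀ b × val₀ a ≤ val₀ b
  Inversion a b = pos₀ a < pos₀ b × val₀ b < val₀ a

  Excedance AntiExcedance : Fin n → Set
  Excedance l = pos₀ l < val₀ l
  AntiExcedance l = val₀ l < pos₀ l

  val₀-injective : ∀ {a b} → val₀ a ≡ val₀ b → a ≡ b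
  val₀-injective = Injection.injective (Inverse⇒Injection π) ∘ toℕ-injective

  ≺-or-inversion : ∀ {a b} → pos₀ a < pos₀ b → a ≺ b ⊎ Inversion a b
  ≺-or-inversion {a} {b} a<b with <-cmp (val₀ a) (val₀ b)
  ... | tri< πa<πb _ _ = inj₁ (a<b , πa<πb)
  ... | tri≈ _ πa≡πb _ = ⊥-elim (<-irrefl (cong toℕ (val₀-injective πa≡πb)) a<b)
  ... | tri> _ _ πb<πa = inj₂ (a<b , πb<πa)

  inversion-from-≤ : ∀ {i j} → Excedance i → AntiExcedance j →
                     pos₀ i ≤ pos₀ j → val₀ j ≤ val₀ i → Inversion i j
  inversion-from-≤ {i} {j} exc anti i≤j πj≤πi =
    ≤∧≢⇒< i≤j (i≢j ∘ toℕ-injective) , ≤∧≢⇒< πj≤πi (i≢j ∘ sym ∘ val₀-injective)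
    where
    i≢j : i ≢ j
    i≢j refl = <-asym exc anti

  head-≼ : ∀ {x xs} → AllPairs _≺_ (x ∷ xs) → All (x ≼_) (x ∷ xs)
  head-≼ (x≺xs ∷ _) = (≤-refl , ≤-refl) ∷ All.map (Product.map <⇒≤ <⇒≤) x≺xs

  count-val₀< : ∀ c → c ≤ n → count (λ l → val₀ l <ᵇ c) (allFin n) ≡ c
  count-val₀< c c≤n = trans (count-permute π (λ m → toℕ m <ᵇ c)) (count-toℕ< c c≤n)

  invᵇ : Fin n → Fin n → Bool
  invᵇ a b = (pos₀ a <ᵇ pos₀ b) ∧ (val₀ b <ᵇ val₀ a)

  between beyond : Fin n → Fin n → Fin n → Bool
  between i j l = (pos₀ i <ᵇ pos₀ l) ∧ (pos₀ l <ᵇ pos₀ j) ∧ (val₀ i <ᵇ val₀ l)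
  beyond i j l = (pos₀ j <ᵇ pos₀ l) ∧ (val₀ j <ᵇ val₀ l) ∧ (val₀ l <ᵇ val₀ i)

  Between Beyond : Fin n → Fin n → Fin n → Set
  Between i j l = pos₀ i < pos₀ l × pos₀ l < pos₀ j × val₀ i < val₀ l
  Beyond i j l = pos₀ j < pos₀ l × val₀ j < val₀ l × val₀ l < val₀ i

  T-invᵇ : ∀ a b → T (invᵇ a b) ⇔ Inversion a b
  T-invᵇ _ _ = (T-<ᵇ ×-⇔ T-<ᵇ) ⇔-∘ T-∧

  T-between : ∀ i j l → T (between i j l) ⇔ Between i j l
  T-between _ _ _ = (T-<ᵇ ×-⇔ T-<ᵇ ×-⇔ T-<ᵇ) ⇔-∘ T-∧³

  T-beyond : ∀ i j l → T (beyond i j l) ⇔ Beyond i j l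
  T-beyond _ _ _ = (T-<ᵇ ×-⇔ T-<ᵇ ×-⇔ T-<ᵇ) ⇔-∘ T-∧³

  record Admissible (I J : List (Fin n)) : Set where
    constructor mkAdmissible
    field
      I-ascending      : AllPairs _≺_ I
      J-ascending      : AllPairs _≺_ J
      I-excedances     : All Excedance I
      J-antiExcedances : All AntiExcedance J

  open Admissible

  dropˡ : ∀ {i is J} → Admissible (i ∷ is) J → Admissible is J
  dropˡ (mkAdmissible (_ ∷ I↑) J↑ (_ ∷ I⁺) J⁻) = mkAdmissible I↑ J↑ I⁺ J⁻

  dropʳ : ∀ {I j js} → Admissible I (j ∷ js) → Admissible I js
  dropʳ (mkAdmissible I↑ (_ ∷ J↑) I⁺ (_ ∷ J⁻)) = mkAdmissible I↑ J↑ I⁺ J⁻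

  MatchedIn : List (Fin n) → List (Fin n) → Fin n × Fin n → Set
  MatchedIn I J p = proj₁ p ∈ I × proj₂ p ∈ J × Inversion (proj₁ p) (proj₂ p)

  module MatchInduction
    (P : List (Fin n) → List (Fin n) → List (Fin n × Fin n) → Set)
    (nilˡ  : ∀ {J} → Admissible [] J → P [] J [])
    (nilʳ  : ∀ {i is} → Admissible (i ∷ is) [] → P (i ∷ is) [] [])
    (skipʳ : ∀ {i is j js M} → Admissible (i ∷ is) (j ∷ js) → pos₀ j < pos₀ i →
             All (MatchedIn (i ∷ is) js) M → P (i ∷ is) js M → P (i ∷ is) (j ∷ js) M)
    (skipˡ : ∀ {i is j js M} → Admissible (i ∷ is) (j ∷ js) → val₀ i < val₀ j →
             All (MatchedIn is (j ∷ js)) M → P is (j ∷ js) M → P (i ∷ is) (j ∷ js) M)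
    (match : ∀ {i is j js M} → Admissible (i ∷ is) (j ∷ js) → Inversion i j →
             All (MatchedIn is js) M → P is js M → P (i ∷ is) (j ∷ js) ((i , j) ∷ M))
    where

    Result : List (Fin n) → List (Fin n) → Set
    Result I J = P I J (matchAux π I J) × All (MatchedIn I J) (matchAux π I J)

    -- Mutual, so that the lexicographic descent survives the with-abstraction.
    matchAux-ind : ∀ I J → Admissible I J → Result I J
    matchAux-ind∷ : ∀ i is J → Admissible (i ∷ is) J → Result (i ∷ is) J

    matchAux-ind []       J adm = nilˡ adm , []
    matchAux-ind (i ∷ is) J adm = matchAux-ind∷ i is J adm

    matchAux-ind∷ i is [] adm = nilʳ adm , []
    matchAux-ind∷ i is (j ∷ js) adm with pos₀ j <ᵇ pos₀ i | <ᵇ-reflects-< (pos₀ j) (pos₀ i)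
    ... | true  | ofʸ j<i =
      let p , m = matchAux-ind∷ i is js (dropʳ adm)
      in skipʳ adm j<i m p , All.map (Product.map₂ (Product.map₁ there)) m
    ... | false | ofⁿ j≮i with val₀ i <ᵇ val₀ j | <ᵇ-reflects-< (val₀ i) (val₀ j)
    ...   | true  | ofʸ πi<πj =
      let p , m = matchAux-ind is (j ∷ js) (dropˡ adm)
      in skipˡ adm πi<πj m p , All.map (Product.map₁ there) m
    ...   | false | ofⁿ πi≮πj =
      let p , m = matchAux-ind is js (dropʳ (dropˡ adm))
          inv = inversion-from-≤ (All.head (I-excedances adm)) (All.head (J-antiExcedances adm)) (≮⇒≥ j≮i) (≮⇒≥ πi≮πj)
      in match adm inv m p , (here refl , here refl , inv) ∷ All.map (Product.map there (Product.map₁ there)) m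

  inversionsBetween : List (Fin n) → List (Fin n) → ℕ
  inversionsBetween I J = sum (map (λ a → count (invᵇ a) J) I)

  cntIn : List (Fin n) → List (Fin n) → Fin n × Fin n → ℕ
  cntIn I J p = count (between (proj₁ p) (proj₂ p)) I + count (beyond (proj₁ p) (proj₂ p)) J

  weightIn : List (Fin n) → List (Fin n) → List (Fin n × Fin n) → ℕ
  weightIn I J M = sum (map (λ p → suc (cntIn I J p)) M)

  inversionsBetween-[] : ∀ I → inversionsBetween I [] ≡ 0
  inversionsBetween-[] []      = refl
  inversionsBetween-[] (_ ∷ I) = inversionsBetween-[] I

  inversionsBetween-dropʳ : ∀ {I j js} → All (λ a → ¬ T (invᵇ a j)) I →
                            inversionsBetween I (j ∷ js) ≡ inversionsBetween I js
  inversionsBetween-dropʳ {j = j} {js} ¬inv = cong sum (map-cong-local (All.map (λ {a} → count-∷-¬ (invᵇ a) j js) ¬inv))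

  weightIn-dropˡ : ∀ {i is} J {M} → AllPairs _≺_ (i ∷ is) → All (λ p → proj₁ p ∈ is) M →
                   weightIn (i ∷ is) J M ≡ weightIn is J M
  weightIn-dropˡ {i} {is} J (i≺is ∷ _) M₁-in = cong sum (map-cong-local (All.map (cong suc ∘ drop) M₁-in))
    where
    drop : ∀ {p} → proj₁ p ∈ is → cntIn (i ∷ is) J p ≡ cntIn is J p
    drop {a , b} a∈is = cong (_+ count (beyond a b) J) (count-∷-¬ (between a b) i is
      λ t → <-asym (proj₁ (All.lookup i≺is a∈is)) (proj₁ (to (T-between a b i) t)))

  weightIn-dropʳ : ∀ I {j js M} → AllPairs _≺_ (j ∷ js) → All (λ p → proj₂ p ∈ js) M →
                   weightIn I (j ∷ js) M ≡ weightIn I js M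
  weightIn-dropʳ I {j} {js} (j≺js ∷ _) M₂-in = cong sum (map-cong-local (All.map (cong suc ∘ drop) M₂-in))
    where
    drop : ∀ {p} → proj₂ p ∈ js → cntIn I (j ∷ js) p ≡ cntIn I js p
    drop {a , b} b∈js = cong (count (between a b) I +_) (count-∷-¬ (beyond a b) j js
      λ t → <-asym (proj₁ (All.lookup j≺js b∈js)) (proj₁ (to (T-beyond a b j) t)))

  inversionsBetween-matchAux : ∀ I J → Admissible I J → inversionsBetween I J ≡ weightIn I J (matchAux π I J)
  inversionsBetween-matchAux I J adm =
    proj₁ (MatchInduction.matchAux-ind P (λ _ → refl) (λ {i} {is} _ → inversionsBetween-[] (i ∷ is)) skipʳ skipˡ match I J adm)
    where
    open ≡-Reasoning

    P : List (Fin n) → List (Fin n) → List (Fin n × Fin n) → Set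
    P I J M = inversionsBetween I J ≡ weightIn I J M

    skipʳ : ∀ {i is j js M} → Admissible (i ∷ is) (j ∷ js) → pos₀ j < pos₀ i →
            All (MatchedIn (i ∷ is) js) M → P (i ∷ is) js M → P (i ∷ is) (j ∷ js) M
    skipʳ {i} {is} {j} {js} {M} adm j<i M-in ih = begin
      inversionsBetween (i ∷ is) (j ∷ js) ≡⟨ inversionsBetween-dropʳ {js = js} (All.map ¬inv (head-≼ (I-ascending adm))) ⟩
      inversionsBetween (i ∷ is) js       ≡⟨ ih ⟩
      weightIn (i ∷ is) js M              ≡⟨ weightIn-dropʳ (i ∷ is) (J-ascending adm) (All.map (proj₁ ∘ proj₂) M-in) ⟨
      weightIn (i ∷ is) (j ∷ js) M        ∎
      where
      ¬inv : ∀ {a} → i ≼ a → ¬ T (invᵇ a j)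
      ¬inv {a} (i≤a , _) t = <-irrefl refl (<-trans (proj₁ (to (T-invᵇ a j) t)) (<-≤-trans j<i i≤a))

    skipˡ : ∀ {i is j js M} → Admissible (i ∷ is) (j ∷ js) → val₀ i < val₀ j →
            All (MatchedIn is (j ∷ js)) M → P is (j ∷ js) M → P (i ∷ is) (j ∷ js) M
    skipˡ {i} {is} {j} {js} {M} adm πi<πj M-in ih = begin
      inversionsBetween (i ∷ is) (j ∷ js)
        ≡⟨ cong (_+ inversionsBetween is (j ∷ js)) (count-none (All.map ¬inv (head-≼ (J-ascending adm)))) ⟩
      inversionsBetween is (j ∷ js)       ≡⟨ ih ⟩
      weightIn is (j ∷ js) M              ≡⟨ weightIn-dropˡ (j ∷ js) (I-ascending adm) (All.map proj₁ M-in) ⟨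
      weightIn (i ∷ is) (j ∷ js) M        ∎
      where
      ¬inv : ∀ {b} → j ≼ b → ¬ T (invᵇ i b)
      ¬inv {b} (_ , πj≤πb) t = <-irrefl refl (<-trans (proj₂ (to (T-invᵇ i b) t)) (<-≤-trans πi<πj πj≤πb))

    match : ∀ {i is j js M} → Admissible (i ∷ is) (j ∷ js) → Inversion i j →
            All (MatchedIn is js) M → P is js M → P (i ∷ is) (j ∷ js) ((i , j) ∷ M)
    match {i} {is} {j} {js} {M} adm (i<j , πj<πi) M-in ih = begin
      inversionsBetween (i ∷ is) (j ∷ js)
        ≡⟨ cong₂ _+_ (trans (count-∷-T (invᵇ i) j js (from (T-invᵇ i j) (i<j , πj<πi))) (cong suc (count-cong-local after-j)))
                     (sum-map-+ (λ a → 𝟙 (invᵇ a j)) (λ a → count (invᵇ a) js) is) ⟩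
      suc (count (beyond i j) js) + (sum (map (λ a → 𝟙 (invᵇ a j)) is) + inversionsBetween is js)
        ≡⟨ cong (λ x → suc (count (beyond i j) js) + (x + inversionsBetween is js))
                (trans (sum-map-𝟙 (λ a → invᵇ a j) is) (count-cong-local after-i)) ⟩
      suc (count (beyond i j) js) + (count (between i j) is + inversionsBetween is js)
        ≡⟨ rearrange (count (between i j) is) (count (beyond i j) js) (inversionsBetween is js) ⟩
      suc (count (between i j) is + count (beyond i j) js) + inversionsBetween is js
        ≡⟨ cong₂ (λ c w → suc c + w) (sym cntIn-ij) (trans ih (sym drop-ij)) ⟩
      weightIn (i ∷ is) (j ∷ js) ((i , j) ∷ M) ∎
      where
      rearrange : ∀ a b r → suc b + (a + r) ≡ suc (a + b) + r
      rearrange = solve-∀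

      after-j : All (λ b → T (invᵇ i b) ⇔ T (beyond i j b)) js
      after-j = All.map (λ {b} (j<b , πj<πb) → T-⇔ (T-invᵇ i b) (T-beyond i j b)
                  (mk⇔ (λ (_ , πb<πi) → j<b , πj<πb , πb<πi) (λ (_ , _ , πb<πi) → <-trans i<j j<b , πb<πi)))
                (AllPairs.head (J-ascending adm))

      after-i : All (λ a → T (invᵇ a j) ⇔ T (between i j a)) is
      after-i = All.map (λ {a} (i<a , πi<πa) → T-⇔ (T-invᵇ a j) (T-between i j a)
                  (mk⇔ (λ (a<j , _) → i<a , a<j , πi<πa) (λ (_ , a<j , _) → a<j , <-trans πj<πi πi<πa)))
                (AllPairs.head (I-ascending adm))

      cntIn-ij : cntIn (i ∷ is) (j ∷ js) (i , j) ≡ count (between i j) is + count (beyond i j) js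
      cntIn-ij = cong₂ _+_ (count-∷-¬ (between i j) i is (λ t → <-irrefl refl (proj₁ (to (T-between i j i) t))))
                           (count-∷-¬ (beyond i j) j js (λ t → <-irrefl refl (proj₁ (to (T-beyond i j j) t))))

      drop-ij : weightIn (i ∷ is) (j ∷ js) M ≡ weightIn is js M
      drop-ij = trans (weightIn-dropˡ (j ∷ js) (I-ascending adm) (All.map proj₁ M-in))
                      (weightIn-dropʳ is (J-ascending adm) (All.map (proj₁ ∘ proj₂) M-in))

  InversionFree : (Fin n → Bool) → Set
  InversionFree S = ∀ a → T (S a) → ∀ b → T (S b) → ¬ Inversion a b

  count-inversionFree-matchAux : ∀ {S} → InversionFree S → ∀ I J → Admissible I J →
    count S I + count S J + length (matchAux π I J) ≤ length I + length J
  count-inversionFree-matchAux {S} S-free I J adm =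
    proj₁ (MatchInduction.matchAux-ind P nilˡ nilʳ skipʳ skipˡ match I J adm)
    where
    open ≤-Reasoning

    P : List (Fin n) → List (Fin n) → List (Fin n × Fin n) → Set
    P I J M = count S I + count S J + length M ≤ length I + length J

    𝟙≤1 : ∀ b → 𝟙 b ≤ 1
    𝟙≤1 true  = ≤-refl
    𝟙≤1 false = z≤n

    nilˡ : ∀ {J} → Admissible [] J → P [] J []
    nilˡ {J} _ = ≤-trans (≤-reflexive (+-identityʳ _)) (count-≤-length S J)

    nilʳ : ∀ {i is} → Admissible (i ∷ is) [] → P (i ∷ is) [] []
    nilʳ {i} {is} _ = begin
      count S (i ∷ is) + 0 + 0 ≡⟨ trans (+-identityʳ _) (+-identityʳ _) ⟩
      count S (i ∷ is)         ≤⟨ count-≤-length S (i ∷ is) ⟩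
      length (i ∷ is)          ≡⟨ +-identityʳ _ ⟨
      length (i ∷ is) + 0      ∎

    skipʳ : ∀ {i is j js M} → Admissible (i ∷ is) (j ∷ js) → pos₀ j < pos₀ i →
            All (MatchedIn (i ∷ is) js) M → P (i ∷ is) js M → P (i ∷ is) (j ∷ js) M
    skipʳ {i} {is} {j} {js} {M} _ _ _ ih = begin
      count S (i ∷ is) + (𝟙 (S j) + count S js) + length M ≡⟨ shuffle (count S (i ∷ is)) (𝟙 (S j)) (count S js) (length M) ⟩
      count S (i ∷ is) + count S js + length M + 𝟙 (S j) ≤⟨ +-mono-≤ ih (𝟙≤1 (S j)) ⟩
      length (i ∷ is) + length js + 1                    ≡⟨ shuffle′ (length (i ∷ is)) (length js) ⟩
      length (i ∷ is) + suc (length js)                  ∎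
      where
      shuffle : ∀ a s c m → a + (s + c) + m ≡ a + c + m + s
      shuffle = solve-∀
      shuffle′ : ∀ a b → a + b + 1 ≡ a + suc b
      shuffle′ = solve-∀

    skipˡ : ∀ {i is j js M} → Admissible (i ∷ is) (j ∷ js) → val₀ i < val₀ j →
            All (MatchedIn is (j ∷ js)) M → P is (j ∷ js) M → P (i ∷ is) (j ∷ js) M
    skipˡ {i} {is} {j} {js} {M} _ _ _ ih = begin
      𝟙 (S i) + count S is + count S (j ∷ js) + length M ≡⟨ shuffle (𝟙 (S i)) (count S is) (count S (j ∷ js)) (length M) ⟩
      count S is + count S (j ∷ js) + length M + 𝟙 (S i) ≤⟨ +-mono-≤ ih (𝟙≤1 (S i)) ⟩
      length is + length (j ∷ js) + 1                    ≡⟨ shuffle′ (length is) (length (j ∷ js)) ⟩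
      suc (length is) + length (j ∷ js)                  ∎
      where
      shuffle : ∀ s a c m → s + a + c + m ≡ a + c + m + s
      shuffle = solve-∀
      shuffle′ : ∀ a b → a + b + 1 ≡ suc a + b
      shuffle′ = solve-∀

    match : ∀ {i is j js M} → Admissible (i ∷ is) (j ∷ js) → Inversion i j →
            All (MatchedIn is js) M → P is js M → P (i ∷ is) (j ∷ js) ((i , j) ∷ M)
    match {i} {is} {j} {js} {M} _ inv _ ih = begin
      𝟙 (S i) + count S is + (𝟙 (S j) + count S js) + suc (length M)
        ≡⟨ shuffle (𝟙 (S i)) (count S is) (𝟙 (S j)) (count S js) (length M) ⟩
      count S is + count S js + length M + suc (𝟙 (S i) + 𝟙 (S j))
        ≤⟨ +-mono-≤ ih (s≤s (at-most-one (S i) (S j) (λ Si Sj → S-free i Si j Sj inv))) ⟩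
      length is + length js + 2
        ≡⟨ shuffle′ (length is) (length js) ⟩
      suc (length is) + suc (length js) ∎
      where
      shuffle : ∀ s a t c m → s + a + (t + c) + suc m ≡ a + c + m + suc (s + t)
      shuffle = solve-∀
      shuffle′ : ∀ a b → a + b + 2 ≡ suc a + suc b
      shuffle′ = solve-∀
      at-most-one : ∀ x y → (T x → T y → ⊥) → 𝟙 x + 𝟙 y ≤ 1
      at-most-one true  true  x∧y = ⊥-elim (x∧y _ _)
      at-most-one true  false _   = ≤-refl
      at-most-one false y     _   = 𝟙≤1 y

  matchAux-matchedIn : ∀ I J → Admissible I J → All (MatchedIn I J) (matchAux π I J)
  matchAux-matchedIn I J adm =
    proj₂ (MatchInduction.matchAux-ind (λ _ _ _ → ⊤) _ _ (λ _ _ _ _ → _) (λ _ _ _ _ → _) (λ _ _ _ _ → _) I J adm)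

  ascending-unique : ∀ {xs} → AllPairs _≺_ xs → Unique xs
  ascending-unique = AllPairs.map (λ (a<b , _) a≡b → <-irrefl (cong toℕ a≡b) a<b)

  ascending-free : ∀ {xs} → AllPairs _≺_ xs → InversionFree (_∈ᵇ xs)
  ascending-free xs↑ a a∈ b b∈ (a<b , πb<πa) with AllPairs-related xs↑ (to T-∈ᵇ a∈) (to T-∈ᵇ b∈)
  ... | inj₁ refl              = <-irrefl refl a<b
  ... | inj₂ (inj₁ (_ , πa<πb)) = <-asym πa<πb πb<πa
  ... | inj₂ (inj₂ (b<a , _))   = <-asym a<b b<a

  insert-free : ∀ {S x} → InversionFree S → (∀ b → T (S b) → ¬ Inversion x b) →
                (∀ a → T (S a) → ¬ Inversion a x) → InversionFree (insert x S)
  insert-free {S} {x} S-free x↛S S↛x =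
    insert-elim (insert-elim (λ (x<x , _) → <-irrefl refl x<x) x↛S) (λ a Sa → insert-elim (S↛x a Sa) (S-free a Sa))

  cnt-split : ∀ i j → cnt π i j ≡ count (between i j) (allFin n) + count (beyond i j) (allFin n)
  cnt-split i j = trans (length-filter (λ l → between i j l ∨ beyond i j l) (allFin n)) (count-∨ disjoint (allFin n))
    where
    disjoint : Disjoint (between i j) (beyond i j)
    disjoint l btw bey = <-asym (proj₁ (proj₂ (to (T-between i j l) btw))) (proj₁ (to (T-beyond i j l) bey))

  allFin-ascending : AllPairs (λ a b → pos₀ a < pos₀ b) (allFin n)
  allFin-ascending = AllPairsₚ.tabulate⁺-< (λ a<b → a<b)

  record FreeSubset (I J : List (Fin n)) (M : List (Fin n × Fin n)) : Set where
    field
      set    : Fin n → Bool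
      within : ∀ l → T (set l) → l ∈ I ⊎ l ∈ J
      free   : InversionFree set
      large  : length I + length J ≤ count set (allFin n) + length M

  open FreeSubset

  FreeSubset-insert : ∀ {I J M I′ J′ M′} (F : FreeSubset I′ J′ M′) {x} → ¬ T (set F x) →
    (∀ b → T (set F b) → ¬ Inversion x b) → (∀ a → T (set F a) → ¬ Inversion a x) →
    x ∈ I ⊎ x ∈ J → (∀ {l} → l ∈ I′ ⊎ l ∈ J′ → l ∈ I ⊎ l ∈ J) →
    (length I′ + length J′ ≤ count (set F) (allFin n) + length M′ →
     length I + length J ≤ suc (count (set F) (allFin n)) + length M) →
    FreeSubset I J M
  FreeSubset-insert F {x} ¬Fx x↛F F↛x x∈ ⊆ grow = record
    { set    = insert x (set F)
    ; within = insert-elim x∈ (λ l → ⊆ ∘ within F l)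
    ; free   = insert-free (free F) x↛F F↛x
    ; large  = subst (λ c → _ ≤ c + _) (sym (count-insert (set F) x ¬Fx)) (grow (large F))
    }

module Avoiding321 {n : ℕ} {π : Permutation′ n} (avoids : Avoids321 π) where

  open Perm π
  open Admissible

  Exc Anti : List (Fin n)
  Exc = excedances π
  Anti = antiExcedances π

  no-inversion-chain : ∀ {a b c} → Inversion a b → Inversion b c → ⊥
  no-inversion-chain {a} {b} {c} (a<b , πb<πa) (b<c , πc<πb) = avoids (a , b , c , a<b , b<c , πc<πb , πb<πa)

  inversion⇒excedance : ∀ {a b} → Inversion a b → Excedance a
  inversion⇒excedance {a} {b} ab@(a<b , πb<πa) = begin-strict
    pos₀ a                                       ≡⟨ count-toℕ< (pos₀ a) (<⇒≤ (toℕ<n a)) ⟨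
    count (λ l → pos₀ l <ᵇ pos₀ a) (allFin n)
      <⟨ count-mono-< before⇒below (∈-allFin b) (<⇒<ᵇ πb<πa) (λ t → <-asym a<b (<ᵇ⇒< _ _ t)) ⟩
    count (λ l → val₀ l <ᵇ val₀ a) (allFin n)    ≡⟨ count-val₀< (val₀ a) (<⇒≤ (toℕ<n (π ⟨$⟩ʳ a))) ⟩
    val₀ a                                       ∎
    where
    open ≤-Reasoning
    before⇒below : ∀ l → T (pos₀ l <ᵇ pos₀ a) → T (val₀ l <ᵇ val₀ a)
    before⇒below l t with ≺-or-inversion (<ᵇ⇒< _ _ t)
    ... | inj₁ (_ , πl<πa) = <⇒<ᵇ πl<πa
    ... | inj₂ la          = ⊥-elim (no-inversion-chain la ab)

  inversion⇒antiExcedance : ∀ {a b} → Inversion a b → AntiExcedance b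
  inversion⇒antiExcedance {a} {b} ab@(a<b , πb<πa) = begin-strict
    val₀ b                                       ≡⟨ count-val₀< (val₀ b) (<⇒≤ (toℕ<n (π ⟨$⟩ʳ b))) ⟨
    count (λ l → val₀ l <ᵇ val₀ b) (allFin n)
      <⟨ count-mono-< below⇒before (∈-allFin a) (<⇒<ᵇ a<b) (λ t → <-asym πb<πa (<ᵇ⇒< _ _ t)) ⟩
    count (λ l → pos₀ l <ᵇ pos₀ b) (allFin n)    ≡⟨ count-toℕ< (pos₀ b) (<⇒≤ (toℕ<n b)) ⟩
    pos₀ b                                       ∎
    where
    open ≤-Reasoning
    below⇒before : ∀ l → T (val₀ l <ᵇ val₀ b) → T (pos₀ l <ᵇ pos₀ b)
    below⇒before l t with <-cmp (pos₀ l) (pos₀ b)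
    ... | tri< l<b _ _ = <⇒<ᵇ l<b
    ... | tri≈ _ l≡b _ = ⊥-elim (<-irrefl (cong val₀ (toℕ-injective l≡b)) (<ᵇ⇒< _ _ t))
    ... | tri> _ _ b<l = ⊥-elim (no-inversion-chain ab (b<l , <ᵇ⇒< _ _ t))

  excedance-ascending : ∀ {a b} → Excedance a → Excedance b → pos₀ a < pos₀ b → a ≺ b
  excedance-ascending _ exc-b a<b with ≺-or-inversion a<b
  ... | inj₁ a≺b = a≺b
  ... | inj₂ ab  = ⊥-elim (<-asym exc-b (inversion⇒antiExcedance ab))

  antiExcedance-ascending : ∀ {a b} → AntiExcedance a → AntiExcedance b → pos₀ a < pos₀ b → a ≺ b
  antiExcedance-ascending anti-a _ a<b with ≺-or-inversion a<b
  ... | inj₁ a≺b = a≺b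
  ... | inj₂ ab  = ⊥-elim (<-asym anti-a (inversion⇒excedance ab))

  excedances-admissible : Admissible (Exc) (Anti)
  excedances-admissible = record
    { I-ascending      = AllPairs-strengthen excedance-ascending excs (AllPairsₚ.filter⁺ (isExc π ≟true) allFin-ascending)
    ; J-ascending      = AllPairs-strengthen antiExcedance-ascending antis (AllPairsₚ.filter⁺ (isAntiExc π ≟true) allFin-ascending)
    ; I-excedances     = excs
    ; J-antiExcedances = antis
    }
    where
    excs : All Excedance (Exc)
    excs = All.map (<ᵇ⇒< _ _ ∘ from T-≡) (Allₚ.all-filter (isExc π ≟true) (allFin n))
    antis : All AntiExcedance (Anti)
    antis = All.map (<ᵇ⇒< _ _ ∘ from T-≡) (Allₚ.all-filter (isAntiExc π ≟true) (allFin n))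

  inv≡inversionsBetween : inv π ≡ inversionsBetween (Exc) (Anti)
  inv≡inversionsBetween = begin
    inv π
      ≡⟨ cong sum (map-cong (λ a → length-filter (invᵇ a) (allFin n)) (allFin n)) ⟩
    sum (map (λ a → count (invᵇ a) (allFin n)) (allFin n))
      ≡⟨ cong sum (map-cong (λ a → count-filter-implied (to-anti a) (allFin n)) (allFin n)) ⟨
    sum (map (λ a → count (invᵇ a) (Anti)) (allFin n)) ≡⟨ sum-map-filter (λ a → count (invᵇ a) (Anti)) from-exc (allFin n) ⟨
    inversionsBetween (Exc) (Anti)            ∎
    where
    open ≡-Reasoning
    to-anti : ∀ a b → T (invᵇ a b) → T (isAntiExc π b)
    to-anti a b t = <⇒<ᵇ (inversion⇒antiExcedance (to (T-invᵇ a b) t))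
    from-exc : ∀ a → ¬ T (isExc π a) → count (invᵇ a) (Anti) ≡ 0
    from-exc a ¬exc = count-none (All.universal (λ b t → ¬exc (<⇒<ᵇ (inversion⇒excedance (to (T-invᵇ a b) t)))) (Anti))

  cnt≡cntIn : ∀ {i j} → Inversion i j → cnt π i j ≡ cntIn (Exc) (Anti) (i , j)
  cnt≡cntIn {i} {j} (i<j , πj<πi) = trans (cnt-split i j)
    (sym (cong₂ _+_ (count-filter-implied between⇒exc (allFin n)) (count-filter-implied beyond⇒anti (allFin n))))
    where
    between⇒exc : ∀ l → T (between i j l) → T (isExc π l)
    between⇒exc l t with to (T-between i j l) t
    ... | _ , l<j , πi<πl = <⇒<ᵇ (inversion⇒excedance (l<j , <-trans πj<πi πi<πl))
    beyond⇒anti : ∀ l → T (beyond i j l) → T (isAntiExc π l)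
    beyond⇒anti l t with to (T-beyond i j l) t
    ... | j<l , _ , πl<πi = <⇒<ᵇ (inversion⇒antiExcedance (<-trans i<j j<l , πl<πi))

  val+pos≡cnt+even : ∀ {i j} → Inversion i j → ∃[ m ] val π i + pos π j ≡ cnt π i j + 2 * m
  val+pos≡cnt+even {i} {j} ij@(i<j , πj<πi) = suc V , (begin
    val π i + pos π j         ≡⟨ cong₂ (λ x y → suc x + y) val-split pos-split ⟩
    suc (V + F) + (V + suc E) ≡⟨ rearrange V E F ⟩
    E + F + 2 * suc V         ≡⟨ cong (_+ 2 * suc V) (cnt-split i j) ⟨
    cnt π i j + 2 * suc V     ∎)
    where
    open ≡-Reasoning

    rearrange : ∀ v e f → suc (v + f) + (v + suc e) ≡ e + f + 2 * suc v
    rearrange = solve-∀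

    weaklyBefore below : Fin n → Bool
    weaklyBefore l = pos₀ l <ᵇ pos π j
    below l = val₀ l <ᵇ val₀ i

    V E F : ℕ
    V = count (λ l → weaklyBefore l ∧ below l) (allFin n)
    E = count (between i j) (allFin n)
    F = count (beyond i j) (allFin n)

    below-after : ∀ l → T (below l ∧ not (weaklyBefore l)) ⇔ T (beyond i j l)
    below-after l = T-⇔ ((T-<ᵇ ×-⇔ T-not-<ᵇ) ⇔-∘ T-∧) (T-beyond i j l) (mk⇔ to′ (λ (j<l , _ , πl<πi) → πl<πi , j<l))
      where
      to′ : val₀ l < val₀ i × pos₀ j < pos₀ l → Beyond i j l
      to′ (πl<πi , j<l) with ≺-or-inversion j<l
      ... | inj₁ (_ , πj<πl) = j<l , πj<πl , πl<πi
      ... | inj₂ jl          = ⊥-elim (<-asym (inversion⇒excedance jl) (inversion⇒antiExcedance ij))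

    weaklyBefore-above : ∀ l → T (weaklyBefore l ∧ not (below l)) ⇔ T (does (l ≟ᶠ i) ∨ between i j l)
    weaklyBefore-above l =
      T-⇔ ((T-<ᵇ ×-⇔ T-not-<ᵇ) ⇔-∘ T-∧) ((T-does (l ≟ᶠ i) ⊎-⇔ T-between i j l) ⇔-∘ T-∨) (mk⇔ to′ from′)
      where
      to′ : pos₀ l < pos π j × val₀ i ≤ val₀ l → l ≡ i ⊎ Between i j l
      to′ (s≤s l≤j , πi≤πl) with l ≟ᶠ i
      ... | yes l≡i = inj₁ l≡i
      ... | no  l≢i = inj₂ (i<l , l<j , πi<πl)
        where
        πi<πl : val₀ i < val₀ l
        πi<πl = ≤∧≢⇒< πi≤πl (l≢i ∘ sym ∘ val₀-injective)
        l<j : pos₀ l < pos₀ j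
        l<j = ≤∧≢⇒< l≤j (λ l≡j → <-irrefl (cong val₀ (sym (toℕ-injective l≡j))) (<-trans πj<πi πi<πl))
        i<l : pos₀ i < pos₀ l
        i<l with <-cmp (pos₀ i) (pos₀ l)
        ... | tri< i<l _ _ = i<l
        ... | tri≈ _ i≡l _ = ⊥-elim (l≢i (sym (toℕ-injective i≡l)))
        ... | tri> _ _ l<i = ⊥-elim (<-asym (inversion⇒excedance ij) (inversion⇒antiExcedance (l<i , πi<πl)))
      from′ : l ≡ i ⊎ Between i j l → pos₀ l < pos π j × val₀ i ≤ val₀ l
      from′ (inj₁ refl)              = s≤s (<⇒≤ i<j) , ≤-refl
      from′ (inj₂ (_ , l<j , πi<πl)) = s≤s (<⇒≤ l<j) , <⇒≤ πi<πl

    val-split : val₀ i ≡ V + F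
    val-split = begin
      val₀ i                      ≡⟨ count-val₀< (val₀ i) (<⇒≤ (toℕ<n (π ⟨$⟩ʳ i))) ⟨
      count below (allFin n)      ≡⟨ count-split below weaklyBefore (allFin n) ⟩
      count (λ l → below l ∧ weaklyBefore l) (allFin n) + count (λ l → below l ∧ not (weaklyBefore l)) (allFin n)
                                  ≡⟨ cong₂ _+_ (count-≗ (λ l → ∧-comm (below l) (weaklyBefore l)) (allFin n))
                                               (count-cong below-after (allFin n)) ⟩
      V + F                       ∎

    pos-split : pos π j ≡ V + suc E
    pos-split = begin
      pos π j                     ≡⟨ count-toℕ< (pos π j) (toℕ<n j) ⟨
      count weaklyBefore (allFin n) ≡⟨ count-split weaklyBefore below (allFin n) ⟩
      V + count (λ l → weaklyBefore l ∧ not (below l)) (allFin n)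
                                  ≡⟨ cong (V +_) (count-cong weaklyBefore-above (allFin n)) ⟩
      V + count (λ l → does (l ≟ᶠ i) ∨ between i j l) (allFin n)
                                  ≡⟨ cong (V +_) (count-∨ i-notBetween (allFin n)) ⟩
      V + (count (λ l → does (l ≟ᶠ i)) (allFin n) + E)
                                  ≡⟨ cong (λ c → V + (c + E)) (count-≟ i) ⟩
      V + suc E                   ∎
      where
      i-notBetween : Disjoint (λ l → does (l ≟ᶠ i)) (between i j)
      i-notBetween l l≡i btw with to (T-does (l ≟ᶠ i)) l≡i
      ... | refl = <-irrefl refl (proj₁ (to (T-between i j i) btw))

  cnt-parity : ∀ {i j} → Inversion i j → (2 ∣ cnt π i j) ⇔ (2 ∣ val π i + pos π j)
  cnt-parity {i} {j} ij with val+pos≡cnt+even ij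
  ... | m , eq = subst (λ x → (2 ∣ cnt π i j) ⇔ (2 ∣ x)) (sym eq) (∣⇔∣+* 2 (cnt π i j) m)


  open FreeSubset

  freeSubset : ∀ I J → Admissible I J → FreeSubset I J (matchAux π I J)
  freeSubset I J adm = proj₁ (MatchInduction.matchAux-ind FreeSubset nilˡ nilʳ skipʳ skipˡ match I J adm)
    where
    grow : ∀ {a b c m} → a + b ≤ c + m → suc a + suc b ≤ suc c + suc m
    grow {a} {b} {c} {m} h = subst₂ _≤_ (cong suc (sym (+-suc a b))) (sym (+-suc (suc c) m)) (s≤s (s≤s h))

    nilˡ : ∀ {J} → Admissible [] J → FreeSubset [] J []
    nilˡ {J} adm = record
      { set    = _∈ᵇ J
      ; within = λ _ t → inj₂ (to T-∈ᵇ t)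
      ; free   = ascending-free (J-ascending adm)
      ; large  = ≤-reflexive (trans (sym (count-∈ᵇ (ascending-unique (J-ascending adm)))) (sym (+-identityʳ _)))
      }

    nilʳ : ∀ {i is} → Admissible (i ∷ is) [] → FreeSubset (i ∷ is) [] []
    nilʳ {i} {is} adm = record
      { set    = _∈ᵇ (i ∷ is)
      ; within = λ _ t → inj₁ (to T-∈ᵇ t)
      ; free   = ascending-free (I-ascending adm)
      ; large  = ≤-reflexive (cong (_+ 0) (sym (count-∈ᵇ (ascending-unique (I-ascending adm)))))
      }

    skipʳ : ∀ {i is j js M} → Admissible (i ∷ is) (j ∷ js) → pos₀ j < pos₀ i →
            All (MatchedIn (i ∷ is) js) M → FreeSubset (i ∷ is) js M → FreeSubset (i ∷ is) (j ∷ js) M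
    skipʳ {i} {is} {j} {js} adm j<i _ F =
      FreeSubset-insert F ¬Fj (λ b _ jb → <-asym (inversion⇒excedance jb) j-anti) F↛j
        (inj₂ (here refl)) (Sum.map₂ there) (λ h → ≤-trans (≤-reflexive (+-suc (length (i ∷ is)) (length js))) (s≤s h))
      where
      j-anti : AntiExcedance j
      j-anti = All.head (J-antiExcedances adm)
      ¬Fj : ¬ T (set F j)
      ¬Fj t with within F j t
      ... | inj₁ j∈I  = <-asym (All.lookup (I-excedances adm) j∈I) j-anti
      ... | inj₂ j∈js = <-irrefl refl (proj₁ (All.lookup (AllPairs.head (J-ascending adm)) j∈js))
      F↛j : ∀ a → T (set F a) → ¬ Inversion a j
      F↛j a Fa aj with within F a Fa
      ... | inj₁ a∈I  = <-irrefl refl (<-trans (proj₁ aj) (<-≤-trans j<i (proj₁ (All.lookup (head-≼ (I-ascending adm)) a∈I))))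
      ... | inj₂ a∈js = <-asym (inversion⇒excedance aj) (All.lookup (All.tail (J-antiExcedances adm)) a∈js)

    skipˡ : ∀ {i is j js M} → Admissible (i ∷ is) (j ∷ js) → val₀ i < val₀ j →
            All (MatchedIn is (j ∷ js)) M → FreeSubset is (j ∷ js) M → FreeSubset (i ∷ is) (j ∷ js) M
    skipˡ {i} {is} {j} {js} adm πi<πj _ F =
      FreeSubset-insert F ¬Fi i↛F (λ a _ ai → <-asym i-exc (inversion⇒antiExcedance ai))
        (inj₁ (here refl)) (Sum.map₁ there) s≤s
      where
      i-exc : Excedance i
      i-exc = All.head (I-excedances adm)
      ¬Fi : ¬ T (set F i)
      ¬Fi t with within F i t
      ... | inj₁ i∈is = <-irrefl refl (proj₁ (All.lookup (AllPairs.head (I-ascending adm)) i∈is))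
      ... | inj₂ i∈J  = <-asym i-exc (All.lookup (J-antiExcedances adm) i∈J)
      i↛F : ∀ b → T (set F b) → ¬ Inversion i b
      i↛F b Fb ib with within F b Fb
      ... | inj₁ b∈is = <-asym (All.lookup (All.tail (I-excedances adm)) b∈is) (inversion⇒antiExcedance ib)
      ... | inj₂ b∈J  =
        <-irrefl refl (<-trans (proj₂ ib) (<-≤-trans πi<πj (proj₂ (All.lookup (head-≼ (J-ascending adm)) b∈J))))

    match : ∀ {i is j js M} → Admissible (i ∷ is) (j ∷ js) → Inversion i j →
            All (MatchedIn is js) M → FreeSubset is js M → FreeSubset (i ∷ is) (j ∷ js) ((i , j) ∷ M)
    -- Keep j if some kept anti-excedance b right of j lies below π_i: a kept
    -- excedance forming an inversion with j would then form one with b.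
    match {i} {is} {j} {js} adm (i<j , πj<πi) _ F with any? (λ b → T? (set F b ∧ (val₀ b <ᵇ val₀ i))) js
    ... | yes below-i = FreeSubset-insert F ¬Fj (λ b _ jb → <-asym (inversion⇒excedance jb) j-anti) F↛j
                          (inj₂ (here refl)) (Sum.map there there) grow
      where
      j-anti : AntiExcedance j
      j-anti = All.head (J-antiExcedances adm)
      ¬Fj : ¬ T (set F j)
      ¬Fj t with within F j t
      ... | inj₁ j∈is = <-asym (All.lookup (All.tail (I-excedances adm)) j∈is) j-anti
      ... | inj₂ j∈js = <-irrefl refl (proj₁ (All.lookup (AllPairs.head (J-ascending adm)) j∈js))
      F↛j : ∀ a → T (set F a) → ¬ Inversion a j
      F↛j a Fa aj with within F a Fa | find below-i
      ... | inj₂ a∈js | _ = <-asym (inversion⇒excedance aj) (All.lookup (All.tail (J-antiExcedances adm)) a∈js)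
      ... | inj₁ a∈is | b , b∈js , Fb∧πb<πi with to T-∧ Fb∧πb<πi
      ...   | Fb , πb<πi = free F a Fa b Fb
                (<-trans (proj₁ aj) (proj₁ (All.lookup (AllPairs.head (J-ascending adm)) b∈js)) ,
                 <-trans (<ᵇ⇒< _ _ πb<πi) (proj₂ (All.lookup (AllPairs.head (I-ascending adm)) a∈is)))
    ... | no none = FreeSubset-insert F ¬Fi i↛F (λ a _ ai → <-asym i-exc (inversion⇒antiExcedance ai))
                      (inj₁ (here refl)) (Sum.map there there) grow
      where
      i-exc : Excedance i
      i-exc = All.head (I-excedances adm)
      ¬Fi : ¬ T (set F i)
      ¬Fi t with within F i t
      ... | inj₁ i∈is = <-irrefl refl (proj₁ (All.lookup (AllPairs.head (I-ascending adm)) i∈is))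
      ... | inj₂ i∈js = <-asym i-exc (All.lookup (All.tail (J-antiExcedances adm)) i∈js)
      i↛F : ∀ b → T (set F b) → ¬ Inversion i b
      i↛F b Fb ib with within F b Fb
      ... | inj₁ b∈is = <-asym (All.lookup (All.tail (I-excedances adm)) b∈is) (inversion⇒antiExcedance ib)
      ... | inj₂ b∈js = none (lose b∈js (from T-∧ (Fb , <⇒<ᵇ (proj₂ ib))))

  fixed : Fin n → Bool
  fixed l = not (isExc π l ∨ isAntiExc π l)

  fixed⇒¬excedance : ∀ {l} → T (fixed l) → ¬ Excedance l
  fixed⇒¬excedance fl exc = subst T (to T-not-≡ fl) (from T-∨ (inj₁ (<⇒<ᵇ exc)))

  fixed⇒¬antiExcedance : ∀ {l} → T (fixed l) → ¬ AntiExcedance l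
  fixed⇒¬antiExcedance {l} fl anti = subst T (to T-not-≡ fl) (from (T-∨ {isExc π l}) (inj₂ (<⇒<ᵇ anti)))

  exc-anti-disjoint : Disjoint (isExc π) (isAntiExc π)
  exc-anti-disjoint l e a = <-asym (<ᵇ⇒< (pos₀ l) (val₀ l) e) (<ᵇ⇒< (val₀ l) (pos₀ l) a)

  count-by-type : ∀ P → count P (allFin n) ≡
    count P (Exc) + count P (Anti) + count (λ l → P l ∧ fixed l) (allFin n)
  count-by-type P = count-partition exc-anti-disjoint P (allFin n)

  n≡excs+antis+fixed : n ≡ length (Exc) + length (Anti) + count fixed (allFin n)
  n≡excs+antis+fixed = begin
    n                             ≡⟨ length-tabulate (λ l → l) ⟨
    length (allFin n)             ≡⟨ count-true (allFin n) ⟨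
    count (const true) (allFin n) ≡⟨ count-by-type (const true) ⟩
    count (const true) (Exc) + count (const true) (Anti) + count fixed (allFin n)
      ≡⟨ cong₂ (λ e a → e + a + count fixed (allFin n)) (count-true (Exc)) (count-true (Anti)) ⟩
    length (Exc) + length (Anti) + count fixed (allFin n) ∎
    where open ≡-Reasoning

  lis+matched≤n : ∀ {k} → IsLis π k → k + length (matchedPairs π) ≤ n
  lis+matched≤n {k} ((s , s-inc , refl) , _) = begin
    length s + length M                    ≡⟨ cong (_+ length M) (count-∈ᵇ (ascending-unique s↑)) ⟨
    count S (allFin n) + length M          ≡⟨ cong (_+ length M) (count-by-type S) ⟩
    count S Exc + count S Anti + count (λ l → S l ∧ fixed l) (allFin n) + length M
                                           ≤⟨ +-monoˡ-≤ (length M) (+-monoʳ-≤ (count S Exc + count S Anti)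
                                                (count-mono (λ l → proj₂ ∘ to T-∧) (allFin n))) ⟩
    count S Exc + count S Anti + count fixed (allFin n) + length M
                                           ≡⟨ xy∙z≈xz∙y (count S Exc + count S Anti) (count fixed (allFin n)) (length M) ⟩
    count S Exc + count S Anti + length M + count fixed (allFin n)
                                           ≤⟨ +-monoˡ-≤ (count fixed (allFin n))
                                                (count-inversionFree-matchAux (ascending-free s↑) Exc Anti excedances-admissible) ⟩
    length Exc + length Anti + count fixed (allFin n)
                                           ≡⟨ n≡excs+antis+fixed ⟨
    n                                      ∎
    where
    open ≤-Reasoning
    M : List (Fin n × Fin n)
    M = matchedPairs π
    s↑ : AllPairs _≺_ s
    s↑ = Linkedₚ.Linked⇒AllPairs (λ (a<b , πa<πb) (b<c , πb<πc) → <-trans a<b b<c , <-trans πa<πb πb<πc) s-inc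
    S : Fin n → Bool
    S = _∈ᵇ s

  n≤lis+matched : ∀ {k} → IsLis π k → n ≤ k + length (matchedPairs π)
  n≤lis+matched {k} (_ , longest) = begin
    n                                                  ≡⟨ n≡excs+antis+fixed ⟩
    length Exc + length Anti + count fixed (allFin n)  ≤⟨ +-monoˡ-≤ (count fixed (allFin n)) (large F) ⟩
    count (set F) (allFin n) + length M + count fixed (allFin n)
                                                       ≡⟨ xy∙z≈xz∙y (count (set F) (allFin n)) (length M) (count fixed (allFin n)) ⟩
    count (set F) (allFin n) + count fixed (allFin n) + length M
                                                       ≡⟨ cong (_+ length M) (count-∨ F#fixed (allFin n)) ⟨
    count S (allFin n) + length M                      ≡⟨ cong (_+ length M) (length-filter S (allFin n)) ⟨
    length s + length M                                ≤⟨ +-monoˡ-≤ (length M) (longest s s-increasing) ⟩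
    k + length M                                       ∎
    where
    open ≤-Reasoning
    M : List (Fin n × Fin n)
    M = matchedPairs π
    F : FreeSubset Exc Anti M
    F = freeSubset Exc Anti excedances-admissible

    S : Fin n → Bool
    S l = set F l ∨ fixed l
    s : List (Fin n)
    s = filter (S ≟true) (allFin n)

    F#fixed : Disjoint (set F) fixed
    F#fixed l Fl fl with within F l Fl
    ... | inj₁ l∈Exc  = fixed⇒¬excedance fl (All.lookup (I-excedances excedances-admissible) l∈Exc)
    ... | inj₂ l∈Anti = fixed⇒¬antiExcedance fl (All.lookup (J-antiExcedances excedances-admissible) l∈Anti)

    S-free : InversionFree S
    S-free a Sa b Sb ab with to T-∨ Sa | to T-∨ Sb
    ... | inj₂ fa | _       = fixed⇒¬excedance fa (inversion⇒excedance ab)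
    ... | inj₁ _  | inj₂ fb = fixed⇒¬antiExcedance fb (inversion⇒antiExcedance ab)
    ... | inj₁ Fa | inj₁ Fb = free F a Fa b Fb ab

    s-increasing : IncSubseq π s
    s-increasing = Linkedₚ.AllPairs⇒Linked (AllPairs-strengthen ascending
      (Allₚ.all-filter (S ≟true) (allFin n)) (AllPairsₚ.filter⁺ (S ≟true) allFin-ascending))
      where
      ascending : ∀ {a b} → S a ≡ true → S b ≡ true → pos₀ a < pos₀ b → a ≺ b
      ascending {a} {b} Sa Sb a<b with ≺-or-inversion a<b
      ... | inj₁ a≺b = a≺b
      ... | inj₂ ab  = ⊥-elim (S-free a (from T-≡ Sa) b (from T-≡ Sb) ab)

  length-matchedPairs : ∀ {k} → IsLis π k → length (matchedPairs π) ≡ n ∸ k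
  length-matchedPairs {k} lis =
    sym (trans (cong (_∸ k) (≤-antisym (n≤lis+matched lis) (lis+matched≤n lis))) (m+n∸m≡n k _))

  matchedPairs-matchedIn : All (MatchedIn (Exc) (Anti)) (matchedPairs π)
  matchedPairs-matchedIn = matchAux-matchedIn _ _ excedances-admissible

  inv≡matched+sumC : inv π ≡ length (matchedPairs π) + sumC π
  inv≡matched+sumC = begin
    inv π                                                 ≡⟨ inv≡inversionsBetween ⟩
    inversionsBetween Exc Anti                            ≡⟨ inversionsBetween-matchAux Exc Anti excedances-admissible ⟩
    weightIn Exc Anti M
      ≡⟨ cong sum (map-cong-local (All.map (λ (_ , _ , ij) → cong suc (cnt≡cntIn ij)) matchedPairs-matchedIn)) ⟨
    sum (map (λ p → suc (cnt π (proj₁ p) (proj₂ p))) M)    ≡⟨ sum-map-suc (λ p → cnt π (proj₁ p) (proj₂ p)) M ⟩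
    length M + sumC π                                     ∎
    where
    open ≡-Reasoning
    M : List (Fin n × Fin n)
    M = matchedPairs π

lemma2p2 : (n : ℕ) (π : Permutation′ n) (k : ℕ) → Avoids321 π → IsLis π k →
    ((i j : Fin n) → (i , j) ∈ matchedPairs π →
      ((2 ∣ cnt π i j) ⇔ (2 ∣ (val π i + pos π j))))
    × (inv π ≡ sumC π + (n ∸ k))
lemma2p2 n π k avoids lis = parity , inversions
  where
  open Perm π
  open Avoiding321 avoids

  parity : (i j : Fin n) → (i , j) ∈ matchedPairs π → (2 ∣ cnt π i j) ⇔ (2 ∣ (val π i + pos π j))
  parity i j ij∈ = cnt-parity (proj₂ (proj₂ (All.lookup matchedPairs-matchedIn ij∈)))

  inversions : inv π ≡ sumC π + (n ∸ k)
  inversions = trans inv≡matched+sumC (trans (+-comm _ (sumC π)) (cong (sumC π +_) (length-matchedPairs lis)))
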